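{- Let $n = p^a q$ where $p$ and $q$ are distinct primes and $a \ge 2$. Then $X(n) < 0$.
   Context: For a positive integer $n$, let $\Pi(n)$ denote the sum of the distinct prime divisors of $n$, and let $\mathcal{C}(n)$ denote the sum of all positive divisors of $n$ that are not prime (including $1$ and, when $n$ is not prime, $n$ itself). Define $X(n) = \Pi(n) - \mathcal{C}(n) + n$. -}

module Defs where

open import Data.Nat using (ℕ; suc)
open import Data.Nat.Divisibility using (_∣?_)
open import Data.Nat.Primality using (Prime; prime?)
open import Data.List using (List; filter; map; upTo)
open import Data.Nat.ListAction using (sum)
open import Data.Integer using (ℤ; +_; _+_; _-_)
open import Relation.Nullary.Decidable using (¬?)

divisors : ℕ → List ℕ
divisors n = filter (_∣? n) (map suc (upTo n))

Π : ℕ → ℕ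
Π n = sum (filter prime? (divisors n))

𝒞 : ℕ → ℕ
𝒞 n = sum (filter (λ d → ¬? (prime? d)) (divisors n))

X : ℕ → ℤ
X n = (+ Π n) - (+ 𝒞 n) + (+ n)

-- The prime divisors of n = p^a q are only p and q, so Π(n) ≤ p + q ≤ pq, while 1, pq and n
-- are three distinct non-prime divisors (pq < n because a ≥ 2), so 𝒞(n) ≥ 1 + pq + n.
-- Hence Π(n) + n < 𝒞(n). Both bounds compare the sum of a duplicate-free list with the sum
-- of a list containing it.
module Submission where

open import Defs
open import Data.Nat using (ℕ; _≤_; _^_; _*_)
open import Data.Nat.Primality using (Prime)
open import Data.Integer using (ℤ; +_) renaming (_<_ to _<ℤ_)
open import Relation.Binary.PropositionalEquality using (_≢_)

open import Data.Nat using (suc; _+_; _<_; z≤n; s≤s; z<s; NonZero; NonTrivial; >-nonZero; ≢-nonZero⁻¹; nonTrivial⇒nonZero; nonTrivial⇒n>1)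
open import Data.Nat.Properties
open import Data.Nat.Divisibility using (_∣_; _∣?_; 1∣_; ∣-refl; ∣⇒≤; 0∣⇒≡0; ∣1⇒≡1; m∣m*n; *-monoˡ-∣)
open import Data.Nat.Primality
open import Data.Nat.ListAction using (sum)
open import Data.Nat.ListAction.Properties using (sum-↭)
open import Data.Nat.Tactic.RingSolver using (solve-∀)
open import Data.List using (List; []; _∷_; _++_; [_]; filter; map; upTo)
open import Data.List.Membership.Propositional using (_∈_)
open import Data.List.Membership.Propositional.Properties using (∈-∃++; ∈-map⁺; ∈-upTo⁺; ∈-filter⁺; ∈-filter⁻)
open import Data.List.Relation.Unary.Any using (here; there)
open import Data.List.Relation.Unary.All as All using ()
open import Data.List.Relation.Unary.AllPairs using ([]; _∷_)
open import Data.List.Relation.Unary.Unique.Propositional using (Unique)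
import Data.List.Relation.Unary.Unique.Propositional.Properties as Unique
open import Data.List.Relation.Binary.Subset.Propositional using (_⊆_)
open import Data.List.Relation.Binary.Permutation.Propositional.Properties using (shift; ∈-resp-↭)
open import Data.Product using (_,_)
open import Data.Sum using (_⊎_; inj₁; inj₂; [_,_]′)
open import Function using (id)
open import Relation.Nullary using (¬_; ¬?; contradiction)
open import Relation.Binary.PropositionalEquality using (_≡_; refl; sym; cong; subst)
import Data.Integer as ℤ
import Data.Integer.Properties as ℤ
import Data.Integer.Tactic.RingSolver as ℤ

sum-mono-⊆ : {xs ys : List ℕ} → Unique xs → xs ⊆ ys → sum xs ≤ sum ys
sum-mono-⊆ {[]} _ _ = z≤n
sum-mono-⊆ {x ∷ xs} (x∉xs ∷ uniq) x∷xs⊆ys with as , bs , refl ← ∈-∃++ (x∷xs⊆ys (here refl)) =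
  begin
    x + sum xs          ≤⟨ +-monoʳ-≤ x (sum-mono-⊆ uniq xs⊆as++bs) ⟩
    x + sum (as ++ bs)  ≡⟨ sum-↭ (shift x as bs) ⟨
    sum (as ++ [ x ] ++ bs) ∎
  where
  open ≤-Reasoning
  xs⊆as++bs : xs ⊆ as ++ bs
  xs⊆as++bs {z} z∈xs with ∈-resp-↭ (shift x as bs) (x∷xs⊆ys (there z∈xs))
  ... | here z≡x  = contradiction (sym z≡x) (All.lookup x∉xs z∈xs)
  ... | there z∈  = z∈

divisors-unique : ∀ n → Unique (divisors n)
divisors-unique n =
  Unique.filter⁺ (_∣? n) (Unique.map⁺ suc-injective (Unique.applyUpTo⁺₁ id n (λ i<j _ → <⇒≢ i<j)))

∈-divisors⁺ : ∀ {d n} .{{_ : NonZero n}} → d ∣ n → d ∈ divisors n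
∈-divisors⁺ {0}     {n} 0∣n = contradiction (0∣⇒≡0 0∣n) (≢-nonZero⁻¹ n)
∈-divisors⁺ {suc d}     d∣n = ∈-filter⁺ (_∣? _) (∈-map⁺ suc (∈-upTo⁺ (∣⇒≤ d∣n))) d∣n

∈-divisors⁻ : ∀ {d n} → d ∈ divisors n → d ∣ n
∈-divisors⁻ {n = n} d∈ with _ , d∣n ← ∈-filter⁻ (_∣? n) {xs = map suc (upTo n)} d∈ = d∣n

Π[n]≤p+q : ∀ {n p q} → (∀ {r} → Prime r → r ∣ n → r ≡ p ⊎ r ≡ q) → Π n ≤ p + q
Π[n]≤p+q {n} {p} {q} prime-divisors = begin
  Π n          ≤⟨ sum-mono-⊆ (Unique.filter⁺ prime? (divisors-unique n)) ⊆[p,q] ⟩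
  p + (q + 0)  ≡⟨ cong (λ k → p + k) (+-identityʳ q) ⟩
  p + q        ∎
  where
  open ≤-Reasoning
  ⊆[p,q] : filter prime? (divisors n) ⊆ p ∷ q ∷ []
  ⊆[p,q] r∈ with r∈divisors , r-prime ← ∈-filter⁻ prime? r∈
    with prime-divisors r-prime (∈-divisors⁻ r∈divisors)
  ... | inj₁ refl = here refl
  ... | inj₂ refl = there (here refl)

1+m+n≤𝒞[n] : ∀ {m n} → Composite m → m ∣ n → m < n → 1 + m + n ≤ 𝒞 n
1+m+n≤𝒞[n] {m} {n} m-composite m∣n m<n = begin
  1 + m + n            ≡⟨ cong (λ k → 1 + m + k) (+-identityʳ n) ⟨
  1 + (m + (n + 0))    ≤⟨ sum-mono-⊆ [1,m,n]-unique [1,m,n]⊆ ⟩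
  𝒞 n                  ∎
  where
  open ≤-Reasoning
  instance
    _ = >-nonZero (≤-<-trans z≤n m<n)
    _ = composite⇒nonTrivial m-composite
  1<m : 1 < m
  1<m = nonTrivial⇒n>1 m
  [1,m,n]-unique : Unique (1 ∷ m ∷ n ∷ [])
  [1,m,n]-unique = (<⇒≢ 1<m All.∷ <⇒≢ (<-trans 1<m m<n) All.∷ All.[])
                 ∷ (<⇒≢ m<n All.∷ All.[]) ∷ All.[] ∷ []
  non-prime-divisor : ∀ {d} → d ∣ n → ¬ Prime d → d ∈ filter (λ d → ¬? (prime? d)) (divisors n)
  non-prime-divisor d∣n ¬prime = ∈-filter⁺ (λ d → ¬? (prime? d)) (∈-divisors⁺ d∣n) ¬prime
  [1,m,n]⊆ : 1 ∷ m ∷ n ∷ [] ⊆ filter (λ d → ¬? (prime? d)) (divisors n)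
  [1,m,n]⊆ (here refl)                 = non-prime-divisor (1∣ n) ¬prime[1]
  [1,m,n]⊆ (there (here refl))         = non-prime-divisor m∣n (composite⇒¬prime m-composite)
  [1,m,n]⊆ (there (there (here refl))) = non-prime-divisor ∣-refl (composite⇒¬prime (composite-∣ m-composite m∣n))

prime∣prime⇒≡ : ∀ {p r} → Prime p → Prime r → r ∣ p → r ≡ p
prime∣prime⇒≡ p-prime r-prime r∣p =
  [ (λ r≡1 → contradiction (subst Prime r≡1 r-prime) ¬prime[1]) , id ]′ (prime⇒irreducible p-prime r∣p)

prime∣^⇒∣ : ∀ {r m} k → Prime r → r ∣ m ^ k → r ∣ m
prime∣^⇒∣ 0           r-prime r∣1   = contradiction (subst Prime (∣1⇒≡1 r∣1) r-prime) ¬prime[1]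
prime∣^⇒∣ {m = m} (suc k) r-prime r∣m^k =
  [ id , prime∣^⇒∣ k r-prime ]′ (euclidsLemma m (m ^ k) r-prime r∣m^k)

prime∣p^k*q⇒≡p⊎≡q : ∀ {p q r} k → Prime p → Prime q → Prime r → r ∣ p ^ k * q → r ≡ p ⊎ r ≡ q
prime∣p^k*q⇒≡p⊎≡q {p} {q} k p-prime q-prime r-prime r∣p^k*q
  with euclidsLemma (p ^ k) q r-prime r∣p^k*q
... | inj₁ r∣p^k = inj₁ (prime∣prime⇒≡ p-prime r-prime (prime∣^⇒∣ k r-prime r∣p^k))
... | inj₂ r∣q   = inj₂ (prime∣prime⇒≡ q-prime r-prime r∣q)

composite-* : ∀ m n .{{_ : NonTrivial m}} .{{_ : NonTrivial n}} → Composite (m * n)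
composite-* m n = composite-≢ m (<⇒≢ (m<m*n m n (nonTrivial⇒n>1 n))) (m∣m*n n)
  where
  instance
    _ = nonTrivial⇒nonZero m
    _ = nonTrivial⇒nonZero n
    _ = m*n≢0 m n

m+n≤m*n : ∀ {m n} → 2 ≤ m → 2 ≤ n → m + n ≤ m * n
m+n≤m*n {suc (suc x)} {suc (suc y)} (s≤s (s≤s z≤n)) (s≤s (s≤s z≤n)) = begin
  (2 + x) + (2 + y)                      ≤⟨ m≤m+n _ (x + y + x * y) ⟩
  (2 + x) + (2 + y) + (x + y + x * y)    ≡⟨ expand x y ⟨
  (2 + x) * (2 + y)                      ∎
  where
  open ≤-Reasoning
  expand : ∀ x y → (2 + x) * (2 + y) ≡ (2 + x) + (2 + y) + (x + y + x * y)
  expand = solve-∀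

Π[n]+n<𝒞[n]⇒X[n]<0 : ∀ n → Π n + n < 𝒞 n → X n <ℤ + 0
Π[n]+n<𝒞[n]⇒X[n]<0 n Π[n]+n<𝒞[n] = begin-strict
  + Π n ℤ.- + 𝒞 n ℤ.+ + n    ≡⟨ regroup (+ Π n) (+ n) (+ 𝒞 n) ⟩
  + Π n ℤ.+ + n ℤ.- + 𝒞 n    <⟨ ℤ.+-monoˡ-< (ℤ.- + 𝒞 n) (ℤ.+<+ Π[n]+n<𝒞[n]) ⟩
  + 𝒞 n ℤ.- + 𝒞 n            ≡⟨ ℤ.+-inverseʳ (+ 𝒞 n) ⟩
  + 0                        ∎
  where
  open ℤ.≤-Reasoning
  regroup : ∀ x y z → x ℤ.- z ℤ.+ y ≡ x ℤ.+ y ℤ.- z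
  regroup = ℤ.solve-∀

lemma2 : (p q a : ℕ) → Prime p → Prime q → p ≢ q → 2 ≤ a →
    X (p ^ a * q) <ℤ + 0
lemma2 p q a@(suc (suc k)) p-prime q-prime _ (s≤s (s≤s z≤n)) = Π[n]+n<𝒞[n]⇒X[n]<0 n (begin-strict
  Π n + n        ≤⟨ +-monoˡ-≤ n (Π[n]≤p+q (prime∣p^k*q⇒≡p⊎≡q a p-prime q-prime)) ⟩
  p + q + n      ≤⟨ +-monoˡ-≤ n (m+n≤m*n (nonTrivial⇒n>1 p) (nonTrivial⇒n>1 q)) ⟩
  p * q + n      <⟨ n<1+n _ ⟩
  1 + p * q + n  ≤⟨ 1+m+n≤𝒞[n] (composite-* p q) (*-monoˡ-∣ q (m∣m*n {p} (p ^ suc k))) pq<n ⟩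
  𝒞 n            ∎)
  where
  open ≤-Reasoning
  instance
    _ = prime⇒nonTrivial p-prime
    _ = prime⇒nonTrivial q-prime
    _ = prime⇒nonZero p-prime
    _ = prime⇒nonZero q-prime
  n : ℕ
  n = p ^ a * q
  pq<n : p * q < n
  pq<n = *-monoˡ-< q (m<m*n p (p ^ suc k) (^-monoʳ-< p (nonTrivial⇒n>1 p) {0} {suc k} z<s))
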